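{- Let $G=(V,E)$ be a finite loopless multigraph, $K\subseteq V$ with $|K|\ge2$, and $(G^1,G^2,X)$ a $K$-splitting of $(G,K)$. Then for all $\pi\in\Pi_l(X,\pi_X)$ and $i=1,2$, \[ M(G^i_\pi,K^i_\pi)=M(G^i_X,K^i_X)\sum_{\sigma\in\Pi_l(X,\pi_X)}D(G^i,\sigma)\,m(\pi\vee\sigma). \]
   Context: Labelled set partitions: for a finite set $Y$ and a symbol $l\notin Y$, a labelled set partition of $Y$ is $\pi=\{B_1\cup L_1,\dots,B_k\cup L_k\}$ with $\{B_1,\dots,B_k\}$ a set partition of $Y$ and $L_i\in\{\emptyset,\{l\}\}$ (labelled block iff $L_i=\{l\}$). $\Pi_l(Y)$ is the set of these, ordered by $\sigma\le\pi$ iff every block of $\sigma$ (including $l$ if present) is contained in a block of $\pi$; it is a lattice with join $\vee$. $m(\pi)=1$ if $\pi$ has exactly one labelled block, else $0$. For $\pi\in\Pi_l(W)$ and $Y\subseteq W$, $\pi\sqcap Y\in\Pi_l(Y)$ has blocks $(B\cap Y)\cup L$ for the blocks $B\cup L$ of $\pi$ with $B\cap Y\ne\emptyset$. Graphs may have parallel edges but no loops. For a graph $H$ on $W$ and $K'\subseteq W$: $M(H,K')=1$ if all of $K'$ lies in one connected component, else $0$; $\{(H,K')\}\in\Pi_l(W)$ has as blocks the vertex sets of connected components, labelled iff meeting $K'$. For $Y\subseteq W$ and a set partition $\rho$ of $Y$, $H_\rho$ identifies the vertices of each block of $\rho$ into one vertex (the block), deletes edges with both endpoints in one block and keeps all other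 edges (parallel edges kept); $H_Y=H_{\{Y\}}$. $K$-splitting: $G^i=(V^i,E^i)$ subgraphs of $G$ with $E^1\cup E^2=E$, $E^1\cap E^2=\emptyset$, $V^1\cup V^2=V$, $V^1\cap V^2=X$, $K^i:=K\cap V^i\ne\emptyset$. $K^i_X=(K^i\setminus X)\cup\{X\}$. $D(G^i,\sigma)=1$ if $\{(G^i,K^i)\}\sqcap X=\sigma$, else $0$. For $\pi=\{B_1\cup L_1,\dots,B_k\cup L_k\}\in\Pi_l(X)$: $G^i_\pi$ is the merging of $G^i$ by $\{B_1,\dots,B_k\}$ and $K^i_\pi=(K^i\setminus X)\cup\{B_j:L_j=\{l\}\text{ or }B_j\cap K^i\ne\emptyset\}$. $\pi_X\in\Pi_l(X)$ is the partition into singletons $\{x\}$, labelled iff $x\in K$; $\Pi_l(X,\pi_X)=\{\pi\in\Pi_l(X):\pi\ge\pi_X,\ \pi\text{ has a labelled block}\}$. -}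

module Defs where

-- Conventions:
--  * vertex set of G is Fin n; edges are indexed by Fin m (so parallel edges are allowed);
--  * subsets of a finite type are Bool-valued predicates ("BSet"); vertices of merged
--    graphs are subsets of Fin n (an original vertex w is represented by {w}, a merged
--    block B by B itself), as in the paper where the new vertex "is" the block;
--  * a labelled set partition of Y ⊆ Fin n is an equivalence relation on Y (rel) together
--    with a block-constant labelling (lab); blocks = equivalence classes, a block is
--    labelled iff lab is true on it.

open import Data.Bool using (Bool; true; false; _∧_; _∨_; not; if_then_else_; T)
import Data.Bool as B
open import Data.Nat using (ℕ; zero; suc; _*_)
open import Data.Fin using (Fin) renaming (zero to fz; suc to fs)
import Data.Fin as F
open import Data.Fin.Subset using (Subset; ⁅_⁆)
open import Data.Vec using (tabulate)
open import Data.Vec.Properties using (≡-dec)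
open import Data.List using (List; []; _∷_; _++_; map; concatMap; length; allFin; filterᵇ)
open import Data.Bool.ListAction using (any; all)
open import Data.Nat.ListAction using (sum)
open import Data.Product using (_×_; _,_; proj₁; proj₂; ∃)
open import Relation.Nullary.Decidable using (⌊_⌋)
open import Relation.Binary.Definitions using (DecidableEquality)
open import Relation.Binary.PropositionalEquality using (_≡_; _≢_)

BSet : ℕ → Set
BSet n = Fin n → Bool

infixr 5 _⇒ᵇ_
_⇒ᵇ_ : Bool → Bool → Bool
a ⇒ᵇ b = not a ∨ b

_==ᵇ_ : Bool → Bool → Bool
a ==ᵇ b = ⌊ a B.≟ b ⌋

anyFin : ∀ {n} → (Fin n → Bool) → Bool
anyFin {n} p = any p (allFin n)

allFin? : ∀ {n} → (Fin n → Bool) → Bool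
allFin? {n} p = all p (allFin n)

toSubset : ∀ {n} → BSet n → Subset n
toSubset = tabulate

_≟ˢ_ : ∀ {n} → DecidableEquality (Subset n)
_≟ˢ_ = ≡-dec B._≟_

record MGraph (A : Set) : Set where
  constructor mgraph
  field
    verts : List A
    edges : List (A × A)
open MGraph public

walk≤ : ∀ {A : Set} → DecidableEquality A → List (A × A) → ℕ → A → A → Bool
walk≤ _≟_ es zero    a b = ⌊ a ≟ b ⌋
walk≤ _≟_ es (suc k) a b = ⌊ a ≟ b ⌋ ∨ any step es
  where
  step : _ → Bool
  step (u , v) = (⌊ u ≟ a ⌋ ∧ walk≤ _≟_ es k v b) ∨ (⌊ v ≟ a ⌋ ∧ walk≤ _≟_ es k u b)

-- same connected component (a walk between two vertices can be shortened to one
-- with fewer edges than there are vertices)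
connected : ∀ {A : Set} → DecidableEquality A → MGraph A → A → A → Bool
connected eq H a b = walk≤ eq (edges H) (length (verts H)) a b

Mv : ∀ {A : Set} → DecidableEquality A → MGraph A → List A → ℕ
Mv eq H K′ = if all (λ a → all (λ b → connected eq H a b) K′) K′ then 1 else 0

record LPart (n : ℕ) : Set where
  constructor lpart
  field
    rel : Fin n → Fin n → Bool
    lab : Fin n → Bool
open LPart public

validLP : ∀ {n} → BSet n → LPart n → Bool
validLP Y π =
  allFin? (λ x → allFin? (λ y → rel π x y ⇒ᵇ (Y x ∧ Y y)))
  ∧ allFin? (λ x → Y x ⇒ᵇ rel π x x)
  ∧ allFin? (λ x → allFin? (λ y → rel π x y ⇒ᵇ rel π y x))
  ∧ allFin? (λ x → allFin? (λ y → allFin? (λ z → (rel π x y ∧ rel π y z) ⇒ᵇ rel π x z)))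
  ∧ allFin? (λ x → lab π x ⇒ᵇ Y x)
  ∧ allFin? (λ x → allFin? (λ y → rel π x y ⇒ᵇ (lab π x ==ᵇ lab π y)))

allFuns : ∀ {A : Set} → List A → (k : ℕ) → List (Fin k → A)
allFuns xs zero    = (λ ()) ∷ []
allFuns xs (suc k) = concatMap (λ a → map (λ f → cons a f) (allFuns xs k)) xs
  where
  cons : ∀ {A : Set} {k} → A → (Fin k → A) → Fin (suc k) → A
  cons a f fz     = a
  cons a f (fs i) = f i

bools : List Bool
bools = true ∷ false ∷ []

-- all candidate pairs (rel, lab); the labelled set partitions of Y are exactly
-- those satisfying validLP Y (each represented exactly once)
allLP : (n : ℕ) → List (LPart n)
allLP n = concatMap (λ r → map (λ l → lpart r l) (allFuns bools n))
                    (allFuns (allFuns bools n) n)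

mv : ∀ {n} → LPart n → ℕ
mv π = if anyFin (lab π)
          ∧ allFin? (λ x → allFin? (λ y → (lab π x ∧ lab π y) ⇒ᵇ rel π x y))
       then 1 else 0

joinLP : ∀ {n} → BSet n → LPart n → LPart n → LPart n
joinLP {n} Y π σ = lpart jr jl
  where
  es : List (Fin n × Fin n)
  es = concatMap (λ x → map (λ y → (x , y))
         (filterᵇ (λ y → rel π x y ∨ rel σ x y) (allFin n))) (allFin n)
  jr : Fin n → Fin n → Bool
  jr x y = Y x ∧ Y y ∧ walk≤ F._≟_ es n x y
  jl : Fin n → Bool
  jl x = Y x ∧ anyFin (λ y → jr x y ∧ (lab π y ∨ lab σ y))

-- π_X : singletons of X, labelled iff in K.   π ≥ π_X and π has a labelled block:
inΠlXπX : ∀ {n} → BSet n → BSet n → LPart n → Bool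
inΠlXπX X K π = validLP X π
                ∧ allFin? (λ x → (X x ∧ K x) ⇒ᵇ lab π x)
                ∧ anyFin (lab π)

-- Vertices of H_ρ are
-- {w} for w ∉ Y and the blocks of ρ; edges inside a block are deleted, all
-- other edges are kept (with multiplicity).

mergeImg : ∀ {n} → BSet n → (Fin n → Fin n → Bool) → Fin n → Subset n
mergeImg Y ρ w = if Y w then toSubset (ρ w) else ⁅ w ⁆

merge : ∀ {n} → BSet n → (Fin n → Fin n → Bool) → MGraph (Fin n) → MGraph (Subset n)
merge Y ρ H = mgraph (map f (verts H)) (concatMap g (edges H))
  where
  f = mergeImg Y ρ
  g : _ → List (Subset _ × Subset _)
  g (u , v) = if ⌊ f u ≟ˢ f v ⌋ then [] else (f u , f v) ∷ []

-- The graph G (vertices Fin n, edges e : Fin m → Fin n × Fin n) and a splitting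
-- given by V : Fin 2 → BSet n (V^1, V^2) and side : Fin m → Fin 2 (edge j lies in
-- E^(side j); this makes E^1 ∪ E^2 = E a disjoint union).

module Splitting {n m : ℕ} (e : Fin m → Fin n × Fin n) (K : BSet n)
                 (V : Fin 2 → BSet n) (side : Fin m → Fin 2) where

  X : BSet n
  X v = V fz v ∧ V (fs fz) v

  Ki : Fin 2 → BSet n
  Ki i v = K v ∧ V i v

  Gi : Fin 2 → MGraph (Fin n)
  Gi i = mgraph (filterᵇ (V i) (allFin n))
                (map e (filterᵇ (λ j → ⌊ side j F.≟ i ⌋) (allFin m)))

  record IsKSplitting : Set where
    field
      cover    : ∀ v → T (V fz v ∨ V (fs fz) v)
      edgesIn  : ∀ j → T (V (side j) (proj₁ (e j)) ∧ V (side j) (proj₂ (e j)))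
      Kmeets   : ∀ i → ∃ λ v → T (Ki i v)

  Giπ : Fin 2 → LPart n → MGraph (Subset n)
  Giπ i π = merge X (rel π) (Gi i)

  Kiπ : Fin 2 → LPart n → List (Subset n)
  Kiπ i π = map ⁅_⁆ (filterᵇ (λ v → Ki i v ∧ not (X v)) (allFin n))
            ++ map (λ x → toSubset (rel π x))
                   (filterᵇ (λ x → X x ∧ (lab π x ∨ anyFin (λ y → rel π x y ∧ Ki i y)))
                            (allFin n))

  GiX : Fin 2 → MGraph (Subset n)
  GiX i = merge X (λ x y → X x ∧ X y) (Gi i)

  KiX : Fin 2 → List (Subset n)
  KiX i = map ⁅_⁆ (filterᵇ (λ v → Ki i v ∧ not (X v)) (allFin n)) ++ (toSubset X ∷ [])

  Dv : Fin 2 → LPart n → ℕ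
  Dv i σ = if validLP X σ
              ∧ allFin? (λ x → allFin? (λ y → (X x ∧ X y) ⇒ᵇ
                    (rel σ x y ==ᵇ connected F._≟_ (Gi i) x y)))
              ∧ allFin? (λ x → X x ⇒ᵇ
                    (lab σ x ==ᵇ anyFin (λ k → Ki i k ∧ connected F._≟_ (Gi i) x k)))
           then 1 else 0

  RHSsum : Fin 2 → LPart n → ℕ
  RHSsum i π = sum (map (λ σ → if inΠlXπX X K σ then Dv i σ * mv (joinLP X π σ) else 0)
                        (allLP n))

Loopless : ∀ {n m} → (Fin m → Fin n × Fin n) → Set
Loopless e = ∀ j → proj₁ (e j) ≢ proj₂ (e j)

AtLeastTwo : ∀ {n} → BSet n → Set
AtLeastTwo K = ∃ λ u → ∃ λ v → u ≢ v × T (K u) × T (K v)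

module Submission where

-- The argument for the theorem: D(G^i, σ) = 1 with σ ∈ Π_l(X, π_X) holds for
-- exactly one σ, the trace σ₀ of the components of G^i on X, provided σ₀ has a
-- labelled block; this is guaranteed when M(G^i_X, K^i_X) = 1, so the sum is
-- m(π ∨ σ₀).  Comparing walks shows m(π ∨ σ₀) = M(G^i_π, K^i_π) (module Core):
-- stretches of G^i-edges between points of X are exactly σ₀-steps.  Finally,
-- M(G^i_π, K^i_π) = 1 forces M(G^i_X, K^i_X) = 1 since X is merged coarser,
-- so both sides vanish together when M(G^i_X, K^i_X) = 0.

open import Defs
open import Data.Bool using (Bool; true; false; _∧_; _∨_; not; if_then_else_; T; T?)
open import Data.Bool.Properties using (T-∧; T-∨; T-≡)
open import Data.Nat using (ℕ; zero; suc; _+_; _*_; _≤_; z≤n; s≤s)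
open import Data.Nat.Properties using (≤-trans; ≤-refl; ≤-pred; *-zeroʳ; *-suc; *-identityʳ; +-identityʳ)
open import Data.Fin using (Fin)
import Data.Fin as Fin
open import Data.Fin.Subset using (Subset; ⁅_⁆) renaming (_∈_ to _∈ˢ_)
open import Data.Fin.Subset.Properties using (x∈⁅x⁆; x∈⁅y⁆⇒x≡y)
open import Data.Vec using (tabulate)
open import Data.Vec.Properties using (lookup∘tabulate; tabulate-cong; []=⇒lookup; lookup⇒[]=)
open import Data.List using (List; []; _∷_; _++_; length; allFin; filter; filterᵇ; map; concatMap)
open import Data.Nat.ListAction using (sum)
open import Data.Nat.ListAction.Properties using (sum-++)
open import Data.List.Properties using (filter-notAll; length-tabulate; map-++; map-∘; map-cong)
open import Data.List.Relation.Unary.All as All using ()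
open import Data.List.Relation.Unary.All.Properties using (all⁺; all⁻)
open import Data.List.Relation.Unary.Any using (here)
open import Data.List.Relation.Unary.Any.Properties using (any⁺; any⁻)
open import Data.List.Membership.Propositional using (_∈_; find; lose)
open import Data.List.Membership.Propositional.Properties
  using (∈-allFin; ∈-filter⁺; ∈-filter⁻; ∈-map⁺; ∈-map⁻; ∈-concatMap⁺; ∈-concatMap⁻; ∈-++⁺ˡ; ∈-++⁺ʳ; ∈-++⁻)
open import Data.Bool.ListAction using (any; all)
open import Data.Product using (_×_; _,_; proj₁; proj₂; ∃; Σ-syntax)
open import Data.Sum using (_⊎_; inj₁; inj₂)
open import Data.Empty using (⊥-elim)
open import Function using (Equivalence; _∘_)
open import Relation.Nullary using (¬_; ¬?; Dec; yes; no)
open import Relation.Nullary.Decidable using (⌊_⌋; toWitness; fromWitness)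
open import Relation.Binary.Definitions using (DecidableEquality)
open import Relation.Binary.PropositionalEquality
  using (_≡_; _≢_; refl; sym; trans; cong; cong₂; subst; module ≡-Reasoning)
open import Relation.Binary.Construct.Closure.ReflexiveTransitive as Star
  using (Star; ε; _◅_; _◅◅_)

T-∧⁻ : ∀ {a b} → T (a ∧ b) → T a × T b
T-∧⁻ = Equivalence.to T-∧

T-∧⁺ : ∀ {a b} → T a → T b → T (a ∧ b)
T-∧⁺ p q = Equivalence.from T-∧ (p , q)

T-∨⁻ : ∀ {a b} → T (a ∨ b) → T a ⊎ T b
T-∨⁻ = Equivalence.to T-∨

T-∨ˡ : ∀ {a b} → T a → T (a ∨ b)
T-∨ˡ p = Equivalence.from T-∨ (inj₁ p)

T-∨ʳ : ∀ {a b} → T b → T (a ∨ b)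
T-∨ʳ {a} q = Equivalence.from (T-∨ {a}) (inj₂ q)

T-⇒ᵇ⁻ : ∀ {a b} → T (a ⇒ᵇ b) → T a → T b
T-⇒ᵇ⁻ {true} p _ = p

T-⇒ᵇ⁺ : ∀ {a b} → (T a → T b) → T (a ⇒ᵇ b)
T-⇒ᵇ⁺ {true}  f = f _
T-⇒ᵇ⁺ {false} f = _

T-not⁻ : ∀ {a} → T (not a) → ¬ T a
T-not⁻ {false} _ ()

T-not⁺ : ∀ {a} → ¬ T a → T (not a)
T-not⁺ {true}  ¬a = ¬a _
T-not⁺ {false} ¬a = _

T-ext : ∀ {a b} → (T a → T b) → (T b → T a) → a ≡ b
T-ext {true}  {true}  _ _ = refl
T-ext {true}  {false} f _ = ⊥-elim (f _)
T-ext {false} {true}  _ g = ⊥-elim (g _)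
T-ext {false} {false} _ _ = refl

T-==ᵇ⁻ : ∀ {a b} → T (a ==ᵇ b) → a ≡ b
T-==ᵇ⁻ {a} {b} = toWitness {a? = a Data.Bool.≟ b}

T-==ᵇ⁺ : ∀ {a b} → a ≡ b → T (a ==ᵇ b)
T-==ᵇ⁺ = fromWitness

indicator : Bool → ℕ
indicator b = if b then 1 else 0

indicator-T : ∀ {b} → T b → indicator b ≡ 1
indicator-T {true} _ = refl

indicator-¬T : ∀ {b} → ¬ T b → indicator b ≡ 0
indicator-¬T {true}  ¬b = ⊥-elim (¬b _)
indicator-¬T {false} _  = refl

if-indicator-* : ∀ a b c → (if a then indicator b * c else 0) ≡ (if a ∧ b then c else 0)
if-indicator-* true  true  c = +-identityʳ c
if-indicator-* true  false c = refl
if-indicator-* false b     c = refl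

if-cong : ∀ a {x y : ℕ} → (T a → x ≡ y) → (if a then x else 0) ≡ (if a then y else 0)
if-cong true  x≡y = x≡y _
if-cong false _   = refl

module _ {A : Set} {p : A → Bool} where

  all-∈ : ∀ {xs} → T (all p xs) → ∀ {x} → x ∈ xs → T (p x)
  all-∈ h = All.lookup (all⁺ p _ h)

  ∈-all : ∀ {xs} → (∀ {x} → x ∈ xs → T (p x)) → T (all p xs)
  ∈-all h = all⁻ p (All.tabulate h)

  any-∈ : ∀ {xs} → T (any p xs) → ∃ λ x → x ∈ xs × T (p x)
  any-∈ h = find (any⁻ p _ h)

  ∈-any : ∀ {xs x} → x ∈ xs → T (p x) → T (any p xs)
  ∈-any x∈ px = any⁺ p (lose x∈ px)

  ∈-filterᵇ⁻ : ∀ {xs x} → x ∈ filterᵇ p xs → x ∈ xs × T (p x)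
  ∈-filterᵇ⁻ = ∈-filter⁻ (T? ∘ p)

  ∈-filterᵇ⁺ : ∀ {xs x} → x ∈ xs → T (p x) → x ∈ filterᵇ p xs
  ∈-filterᵇ⁺ = ∈-filter⁺ (T? ∘ p)

module _ {n : ℕ} (p : Fin n → Bool) where

  allFin⁻ : T (allFin? p) → ∀ x → T (p x)
  allFin⁻ h x = all-∈ {p = p} {allFin n} h (∈-allFin x)

  allFin⁺ : (∀ x → T (p x)) → T (allFin? p)
  allFin⁺ h = ∈-all {p = p} {allFin n} (λ {x} _ → h x)

  anyFin⁻ : T (anyFin p) → ∃ λ x → T (p x)
  anyFin⁻ h = let x , _ , px = any-∈ {p = p} {allFin n} h in x , px

  anyFin⁺ : ∀ x → T (p x) → T (anyFin p)
  anyFin⁺ x = ∈-any {p = p} (∈-allFin x)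

module _ {n : ℕ} where

  allFin⇒₁⁻ : ∀ (p q : Fin n → Bool) → T (allFin? (λ x → p x ⇒ᵇ q x)) → ∀ {x} → T (p x) → T (q x)
  allFin⇒₁⁻ p q h {x} = T-⇒ᵇ⁻ (allFin⁻ (λ x → p x ⇒ᵇ q x) h x)

  allFin⇒₁⁺ : ∀ (p q : Fin n → Bool) → (∀ {x} → T (p x) → T (q x)) → T (allFin? (λ x → p x ⇒ᵇ q x))
  allFin⇒₁⁺ p q h = allFin⁺ (λ x → p x ⇒ᵇ q x) (λ x → T-⇒ᵇ⁺ h)

  allFin⇒₂⁻ : ∀ (p q : Fin n → Fin n → Bool) →
              T (allFin? (λ x → allFin? (λ y → p x y ⇒ᵇ q x y))) → ∀ {x y} → T (p x y) → T (q x y)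
  allFin⇒₂⁻ p q h {x} = allFin⇒₁⁻ (p x) (q x) (allFin⁻ (λ x → allFin? (λ y → p x y ⇒ᵇ q x y)) h x)

  allFin⇒₂⁺ : ∀ (p q : Fin n → Fin n → Bool) →
              (∀ {x y} → T (p x y) → T (q x y)) → T (allFin? (λ x → allFin? (λ y → p x y ⇒ᵇ q x y)))
  allFin⇒₂⁺ p q h = allFin⁺ (λ x → allFin? (λ y → p x y ⇒ᵇ q x y)) (λ x → allFin⇒₁⁺ (p x) (q x) h)

Adj : ∀ {A : Set} → List (A × A) → A → A → Set
Adj es a c = (a , c) ∈ es ⊎ (c , a) ∈ es

Adj-sym : ∀ {A : Set} {es : List (A × A)} {a c} → Adj es a c → Adj es c a
Adj-sym (inj₁ m) = inj₂ m
Adj-sym (inj₂ m) = inj₁ m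

steps : ∀ {A : Set} {R : A → A → Set} {a b} → Star R a b → ℕ
steps ε       = 0
steps (_ ◅ w) = suc (steps w)

EdgesWithin : ∀ {A : Set} → List (A × A) → List A → Set
EdgesWithin es vs = ∀ {u v} → (u , v) ∈ es → u ∈ vs × v ∈ vs

-- walk≤ k a b holds exactly when a and b are joined by a walk of at most k
-- edges; a walk can always be shortened to one that does not revisit vertices.

module BoundedWalks {A : Set} (_≟_ : DecidableEquality A) (es : List (A × A)) where

  walk≤-refl : ∀ k a → T (walk≤ _≟_ es k a a)
  walk≤-refl zero    a = fromWitness refl
  walk≤-refl (suc k) a = T-∨ˡ {⌊ a ≟ a ⌋} (fromWitness refl)

  walk≤-step : ∀ k {a c b} → Adj es a c → T (walk≤ _≟_ es k c b) → T (walk≤ _≟_ es (suc k) a b)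
  walk≤-step k {a} {c} {b} (inj₁ m) t =
    T-∨ʳ {⌊ a ≟ b ⌋} (∈-any {xs = es} m (T-∨ˡ (T-∧⁺ (fromWitness {a? = a ≟ a} refl) t)))
  walk≤-step k {a} {c} {b} (inj₂ m) t =
    T-∨ʳ {⌊ a ≟ b ⌋} (∈-any {xs = es} m
      (T-∨ʳ {⌊ c ≟ a ⌋ ∧ walk≤ _≟_ es k a b} (T-∧⁺ (fromWitness {a? = a ≟ a} refl) t)))

  walk≤-sound : ∀ k {a b} → T (walk≤ _≟_ es k a b) → Star (Adj es) a b
  walk≤-sound zero {a} {b} h with toWitness {a? = a ≟ b} h
  ... | refl = ε
  walk≤-sound (suc k) {a} {b} h with T-∨⁻ {⌊ a ≟ b ⌋} h
  ... | inj₁ a≡b with toWitness {a? = a ≟ b} a≡b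
  ...   | refl = ε
  walk≤-sound (suc k) {a} {b} h | inj₂ h′ with any-∈ {xs = es} h′
  ... | (u , v) , m , t with T-∨⁻ {⌊ u ≟ a ⌋ ∧ walk≤ _≟_ es k v b} t
  ...   | inj₁ fwd with T-∧⁻ {⌊ u ≟ a ⌋} fwd
  ...     | u≡a , rest with toWitness {a? = u ≟ a} u≡a
  ...       | refl = inj₁ m ◅ walk≤-sound k rest
  walk≤-sound (suc k) {a} {b} h | inj₂ h′ | (u , v) , m , t | inj₂ bwd with T-∧⁻ {⌊ v ≟ a ⌋} bwd
  ...     | v≡a , rest with toWitness {a? = v ≟ a} v≡a
  ...       | refl = inj₂ m ◅ walk≤-sound k rest

  walk≤-complete : ∀ {k a b} (w : Star (Adj es) a b) → steps w ≤ k → T (walk≤ _≟_ es k a b)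
  walk≤-complete {k} {a} ε _ = walk≤-refl k a
  walk≤-complete {suc k} (r ◅ w) (s≤s le) = walk≤-step k r (walk≤-complete w le)

  -- Walks whose every vertex after the first satisfies P.
  Inside : (A → Set) → A → A → Set
  Inside P a c = Adj es a c × P c

  -- The part of a walk after its last visit to c (if any) avoids c.
  avoid : ∀ {P : A → Set} c {a b} → Star (Inside P) a b →
          Star (Inside (λ x → P x × x ≢ c)) a b ⊎ Star (Inside (λ x → P x × x ≢ c)) c b
  avoid c ε = inj₁ ε
  avoid c (_◅_ {j = d} (r , p) w) with avoid c w
  ... | inj₂ w′ = inj₂ w′
  ... | inj₁ w′ with d ≟ c
  ...   | yes refl = inj₂ w′
  ...   | no  d≢c  = inj₁ ((r , p , d≢c) ◅ w′)

  avoid-from : ∀ {P : A → Set} c {b} → Star (Inside P) c b → Star (Inside (λ x → P x × x ≢ c)) c b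
  avoid-from c w with avoid c w
  ... | inj₁ w′ = w′
  ... | inj₂ w′ = w′

  -- A walk inside vs has a short version with at most length vs edges
  -- (fuel N bounds length vs, which shrinks at every step).
  shorten : ∀ N vs → length vs ≤ N → ∀ {a b} → Star (Inside (_∈ vs)) a b →
            Σ[ w ∈ Star (Adj es) a b ] steps w ≤ length vs
  shorten N vs _ ε = ε , z≤n
  shorten zero [] _ ((_ , ()) ◅ _)
  shorten zero (_ ∷ _) () (_ ◅ _)
  shorten (suc N) vs vs≤N (_◅_ {j = c} (r , c∈vs) w) =
    let w′ , w′≤ = shorten N rest (≤-pred (≤-trans rest<vs vs≤N)) (Star.map restrict (avoid-from c w))
    in r ◅ w′ , ≤-trans (s≤s w′≤) rest<vs
    where
    rest : List A
    rest = filter (λ x → ¬? (x ≟ c)) vs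
    rest<vs : suc (length rest) ≤ length vs
    rest<vs = filter-notAll (λ x → ¬? (x ≟ c)) vs (lose c∈vs (λ c≢c → c≢c refl))
    restrict : ∀ {a d} → Inside (λ x → x ∈ vs × x ≢ c) a d → Inside (_∈ rest) a d
    restrict (r , d∈vs , d≢c) = r , ∈-filter⁺ (λ x → ¬? (x ≟ c)) d∈vs d≢c

  walk≤-connected : ∀ vs → EdgesWithin es vs → ∀ {a b} → Star (Adj es) a b → T (walk≤ _≟_ es (length vs) a b)
  walk≤-connected vs within w =
    let w′ , short = shorten (length vs) vs ≤-refl (Star.map inside w) in walk≤-complete w′ short
    where
    inside : ∀ {a c} → Adj es a c → Inside (_∈ vs) a c
    inside (inj₁ m) = inj₁ m , proj₂ (within m)
    inside (inj₂ m) = inj₂ m , proj₁ (within m)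

module Connectivity {A : Set} (_≟_ : DecidableEquality A) (H : MGraph A) where
  open BoundedWalks _≟_ (edges H)

  connected-sound : ∀ {a b} → T (connected _≟_ H a b) → Star (Adj (edges H)) a b
  connected-sound = walk≤-sound (length (verts H))

  connected-complete : EdgesWithin (edges H) (verts H) → ∀ {a b} → Star (Adj (edges H)) a b → T (connected _≟_ H a b)
  connected-complete = walk≤-connected (verts H)

∈-toSubset⁺ : ∀ {n} {g : BSet n} {x} → T (g x) → x ∈ˢ toSubset g
∈-toSubset⁺ {g = g} {x} gx = lookup⇒[]= x (tabulate g) (trans (lookup∘tabulate g x) (Equivalence.to T-≡ gx))

∈-toSubset⁻ : ∀ {n} {g : BSet n} {x} → x ∈ˢ toSubset g → T (g x)
∈-toSubset⁻ {g = g} {x} x∈ = Equivalence.from T-≡ (trans (sym (lookup∘tabulate g x)) ([]=⇒lookup x∈))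

record IsEquivOn {n : ℕ} (Y : BSet n) (ρ : Fin n → Fin n → Bool) : Set where
  field
    supported  : ∀ {x y} → T (ρ x y) → T (Y x) × T (Y y)
    reflexive  : ∀ {x} → T (Y x) → T (ρ x x)
    symmetric  : ∀ {x y} → T (ρ x y) → T (ρ y x)
    transitive : ∀ {x y z} → T (ρ x y) → T (ρ y z) → T (ρ x z)

module _ {n : ℕ} (Y : BSet n) (ρ : Fin n → Fin n → Bool) where

  mergeImg-inside : ∀ {a} → T (Y a) → mergeImg Y ρ a ≡ toSubset (ρ a)
  mergeImg-inside ya rewrite Equivalence.to T-≡ ya = refl

  mergeImg-outside : ∀ {a} → ¬ T (Y a) → mergeImg Y ρ a ≡ ⁅ a ⁆
  mergeImg-outside {a} ¬ya with Y a
  ... | true  = ⊥-elim (¬ya _)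
  ... | false = refl

-- Connectivity in the merged graph H_ρ: two images are joined iff the original
-- vertices are joined by a walk that uses edges of H and jumps inside blocks of ρ.

module Merging {n : ℕ} {Y : BSet n} {ρ : Fin n → Fin n → Bool} (ρ-equiv : IsEquivOn Y ρ)
               (H : MGraph (Fin n)) where
  open IsEquivOn ρ-equiv

  img : Fin n → Subset n
  img = mergeImg Y ρ

  Hρ : MGraph (Subset n)
  Hρ = merge Y ρ H

  Move : Fin n → Fin n → Set
  Move a c = Adj (edges H) a c ⊎ T (ρ a c)

  Move-sym : ∀ {a c} → Move a c → Move c a
  Move-sym (inj₁ r) = inj₁ (Adj-sym r)
  Move-sym (inj₂ t) = inj₂ (symmetric t)

  ∈-img-self : ∀ a → a ∈ˢ img a
  ∈-img-self a with T? (Y a)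
  ... | yes ya = subst (a ∈ˢ_) (sym (mergeImg-inside Y ρ ya)) (∈-toSubset⁺ (reflexive ya))
  ... | no ¬ya = subst (a ∈ˢ_) (sym (mergeImg-outside Y ρ ¬ya)) (x∈⁅x⁆ a)

  ∈-img⁻ : ∀ {x} c → x ∈ˢ img c → x ≡ c ⊎ T (ρ c x)
  ∈-img⁻ c x∈ with T? (Y c)
  ... | yes yc = inj₂ (∈-toSubset⁻ (subst (_ ∈ˢ_) (mergeImg-inside Y ρ yc) x∈))
  ... | no ¬yc = inj₁ (x∈⁅y⁆⇒x≡y c (subst (_ ∈ˢ_) (mergeImg-outside Y ρ ¬yc) x∈))

  img-cong : ∀ {a c} → T (ρ a c) → img a ≡ img c
  img-cong {a} {c} t =
    let ya , yc = supported t
    in trans (mergeImg-inside Y ρ ya)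
         (trans (tabulate-cong (λ z → T-ext (transitive (symmetric t)) (transitive t)))
                (sym (mergeImg-inside Y ρ yc)))

  img-inj : ∀ {a c} → img a ≡ img c → Star Move a c
  img-inj {a} {c} e with ∈-img⁻ c (subst (a ∈ˢ_) e (∈-img-self a))
  ... | inj₁ refl = ε
  ... | inj₂ t    = inj₂ (symmetric t) ◅ ε

  mergedEdges : Fin n × Fin n → List (Subset n × Subset n)
  mergedEdges (u , v) = if ⌊ img u ≟ˢ img v ⌋ then [] else (img u , img v) ∷ []

  merged-edge⁻ : ∀ {p q} → (p , q) ∈ edges Hρ →
                 ∃ λ u → ∃ λ v → (u , v) ∈ edges H × p ≡ img u × q ≡ img v
  merged-edge⁻ m with find (∈-concatMap⁻ mergedEdges {xs = edges H} m)
  ... | (u , v) , uv∈ , pq∈ with img u ≟ˢ img v | pq∈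
  ...   | no _ | here refl = u , v , uv∈ , refl , refl

  merged-edge⁺ : ∀ {u v} → (u , v) ∈ edges H → img u ≡ img v ⊎ (img u , img v) ∈ edges Hρ
  merged-edge⁺ {u} {v} uv∈ with img u ≟ˢ img v
  ... | yes e = inj₁ e
  ... | no ne = inj₂ (∈-concatMap⁺ mergedEdges (lose uv∈ (kept ne)))
    where
    kept : img u ≢ img v → (img u , img v) ∈ (if ⌊ img u ≟ˢ img v ⌋ then [] else (img u , img v) ∷ [])
    kept ne with img u ≟ˢ img v
    ... | yes e = ⊥-elim (ne e)
    ... | no _  = here refl

  first-entry : ∀ {a b} → Star Move a b → T (Y b) → ∃ λ y → T (Y y) × Star (Adj (edges H)) a y
  first-entry {a} w yb with T? (Y a)
  ... | yes ya = a , ya , ε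
  first-entry ε            yb | no ¬ya = ⊥-elim (¬ya yb)
  first-entry (inj₂ t ◅ w) yb | no ¬ya = ⊥-elim (¬ya (proj₁ (supported t)))
  first-entry (inj₁ r ◅ w) yb | no ¬ya = let y , yy , p = first-entry w yb in y , yy , r ◅ p

  merged-walk⁺ : ∀ {a b} → Star Move a b → Star (Adj (edges Hρ)) (img a) (img b)
  merged-walk⁺ ε = ε
  merged-walk⁺ (inj₂ t ◅ w) rewrite img-cong t = merged-walk⁺ w
  merged-walk⁺ (inj₁ (inj₁ uv∈) ◅ w) with merged-edge⁺ uv∈
  ... | inj₁ e  rewrite e = merged-walk⁺ w
  ... | inj₂ m′ = inj₁ m′ ◅ merged-walk⁺ w
  merged-walk⁺ (inj₁ (inj₂ vu∈) ◅ w) with merged-edge⁺ vu∈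
  ... | inj₁ e  rewrite sym e = merged-walk⁺ w
  ... | inj₂ m′ = inj₂ m′ ◅ merged-walk⁺ w

  merged-walk⁻ : ∀ {p q} → Star (Adj (edges Hρ)) p q → ∀ {a b} → p ≡ img a → q ≡ img b → Star Move a b
  merged-walk⁻ ε pa qb = img-inj (trans (sym pa) qb)
  merged-walk⁻ (inj₁ m ◅ w) pa qb with merged-edge⁻ m
  ... | u , v , uv∈ , refl , refl = img-inj (sym pa) ◅◅ inj₁ (inj₁ uv∈) ◅ merged-walk⁻ w refl qb
  merged-walk⁻ (inj₂ m ◅ w) pa qb with merged-edge⁻ m
  ... | u , v , uv∈ , refl , refl = img-inj (sym pa) ◅◅ inj₁ (inj₂ uv∈) ◅ merged-walk⁻ w refl qb

  merged-within : EdgesWithin (edges H) (verts H) → EdgesWithin (edges Hρ) (verts Hρ)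
  merged-within within m with merged-edge⁻ m
  ... | u , v , uv∈ , refl , refl = ∈-map⁺ img (proj₁ (within uv∈)) , ∈-map⁺ img (proj₂ (within uv∈))

  merged-connected⁻ : ∀ {a b} → T (connected _≟ˢ_ Hρ (img a) (img b)) → Star Move a b
  merged-connected⁻ h = merged-walk⁻ (Connectivity.connected-sound _≟ˢ_ Hρ h) refl refl

  merged-connected⁺ : EdgesWithin (edges H) (verts H) →
                      ∀ {a b} → Star Move a b → T (connected _≟ˢ_ Hρ (img a) (img b))
  merged-connected⁺ within w =
    Connectivity.connected-complete _≟ˢ_ Hρ (merged-within within) (merged-walk⁺ w)

AllLinked : ∀ {A : Set} → DecidableEquality A → MGraph A → List A → Bool
AllLinked eq H Ks = all (λ p → all (λ q → connected eq H p q) Ks) Ks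

module MergedTerminals {n : ℕ} {Y : BSet n} {ρ : Fin n → Fin n → Bool} (ρ-equiv : IsEquivOn Y ρ)
                       (H : MGraph (Fin n)) (Ks : List (Subset n)) (P : Fin n → Set) where
  open Merging ρ-equiv H

  Linked : Set
  Linked = ∀ {a b} → P a → P b → Star Move a b

  linked⁻ : (∀ {v} → P v → img v ∈ Ks) → T (AllLinked _≟ˢ_ Hρ Ks) → Linked
  linked⁻ P⊆Ks h pa pb = merged-connected⁻ (all-∈ (all-∈ {xs = Ks} h (P⊆Ks pa)) (P⊆Ks pb))

  linked⁺ : EdgesWithin (edges H) (verts H) → (∀ {p} → p ∈ Ks → ∃ λ v → P v × p ≡ img v) →
            Linked → T (AllLinked _≟ˢ_ Hρ Ks)
  linked⁺ within Ks⊆P linked = ∈-all λ p∈ → ∈-all λ q∈ → joined (Ks⊆P p∈) (Ks⊆P q∈)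
    where
    joined : ∀ {p q} → (∃ λ v → P v × p ≡ img v) → (∃ λ v → P v × q ≡ img v) →
             T (connected _≟ˢ_ Hρ p q)
    joined (v , pv , refl) (w , pw , refl) = merged-connected⁺ within (linked pv pw)

record IsLabelledPartition {n : ℕ} (Y : BSet n) (π : LPart n) : Set where
  field
    isEquivOn      : IsEquivOn Y (rel π)
    labelled⊆      : ∀ {x} → T (lab π x) → T (Y x)
    label-constant : ∀ {x y} → T (rel π x y) → lab π x ≡ lab π y
  open IsEquivOn isEquivOn public

module _ {n : ℕ} (Y : BSet n) (π : LPart n) where
  private
    inY rfl sym′ trn labY : Bool
    inY  = allFin? (λ x → allFin? (λ y → rel π x y ⇒ᵇ (Y x ∧ Y y)))
    rfl  = allFin? (λ x → Y x ⇒ᵇ rel π x x)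
    sym′ = allFin? (λ x → allFin? (λ y → rel π x y ⇒ᵇ rel π y x))
    trn  = allFin? (λ x → allFin? (λ y → allFin? (λ z → (rel π x y ∧ rel π y z) ⇒ᵇ rel π x z)))
    labY = allFin? (λ x → lab π x ⇒ᵇ Y x)

  validLP⁻ : T (validLP Y π) → IsLabelledPartition Y π
  validLP⁻ h =
    let h-inY  , h = T-∧⁻ {inY} h
        h-rfl  , h = T-∧⁻ {rfl} h
        h-sym  , h = T-∧⁻ {sym′} h
        h-trn  , h = T-∧⁻ {trn} h
        h-labY , h-const = T-∧⁻ {labY} h
    in record
      { isEquivOn = record
        { supported  = λ t → T-∧⁻ (allFin⇒₂⁻ (rel π) (λ x y → Y x ∧ Y y) h-inY t)
        ; reflexive  = allFin⇒₁⁻ Y (λ x → rel π x x) h-rfl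
        ; symmetric  = allFin⇒₂⁻ (rel π) (λ x y → rel π y x) h-sym
        ; transitive = λ {x} {y} t u → allFin⇒₁⁻ (λ z → rel π x y ∧ rel π y z) (rel π x)
                         (allFin⁻ _ (allFin⁻ _ h-trn x) y) (T-∧⁺ t u) }
      ; labelled⊆      = allFin⇒₁⁻ (lab π) Y h-labY
      ; label-constant = λ t → T-==ᵇ⁻ (allFin⇒₂⁻ (rel π) (λ x y → lab π x ==ᵇ lab π y) h-const t) }

  validLP⁺ : IsLabelledPartition Y π → T (validLP Y π)
  validLP⁺ v =
    T-∧⁺ {inY} (allFin⇒₂⁺ (rel π) (λ x y → Y x ∧ Y y) (λ t → let yx , yy = supported t in T-∧⁺ yx yy))
    (T-∧⁺ {rfl} (allFin⇒₁⁺ Y (λ x → rel π x x) reflexive)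
    (T-∧⁺ {sym′} (allFin⇒₂⁺ (rel π) (λ x y → rel π y x) symmetric)
    (T-∧⁺ {trn} (allFin⁺ _ λ x → allFin⁺ _ λ y →
                   allFin⇒₁⁺ (λ z → rel π x y ∧ rel π y z) (rel π x)
                     (λ {z} t → let t₁ , t₂ = T-∧⁻ {rel π x y} t in transitive t₁ t₂))
    (T-∧⁺ {labY} (allFin⇒₁⁺ (lab π) Y labelled⊆)
      (allFin⇒₂⁺ (rel π) (λ x y → lab π x ==ᵇ lab π y) (λ t → T-==ᵇ⁺ (label-constant t)))))))
    where open IsLabelledPartition v

record InΠlXπX {n : ℕ} (X K : BSet n) (π : LPart n) : Set where
  field
    partition     : IsLabelledPartition X π
    above-πX      : ∀ {x} → T (X x) → T (K x) → T (lab π x)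
    some-labelled : ∃ λ x → T (lab π x)

module _ {n : ℕ} (X K : BSet n) (π : LPart n) where
  private
    aboveπX : Bool
    aboveπX = allFin? (λ x → (X x ∧ K x) ⇒ᵇ lab π x)

  inΠlXπX⁻ : T (inΠlXπX X K π) → InΠlXπX X K π
  inΠlXπX⁻ h =
    let h-valid , h = T-∧⁻ {validLP X π} h
        h-above , h-some = T-∧⁻ {aboveπX} h
    in record
      { partition     = validLP⁻ X π h-valid
      ; above-πX      = λ xx kx → allFin⇒₁⁻ (λ x → X x ∧ K x) (lab π) h-above (T-∧⁺ xx kx)
      ; some-labelled = anyFin⁻ (lab π) h-some }

  inΠlXπX⁺ : InΠlXπX X K π → T (inΠlXπX X K π)
  inΠlXπX⁺ v =
    T-∧⁺ {validLP X π} (validLP⁺ X π partition)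
      (T-∧⁺ {aboveπX} (allFin⇒₁⁺ (λ x → X x ∧ K x) (lab π)
                         (λ t → let xx , kx = T-∧⁻ {X _} t in above-πX xx kx))
        (anyFin⁺ (lab π) (proj₁ some-labelled) (proj₂ some-labelled)))
    where open InΠlXπX v

module _ {n : ℕ} (J : LPart n) where
  private
    oneBlock : Bool
    oneBlock = allFin? (λ x → allFin? (λ y → (lab J x ∧ lab J y) ⇒ᵇ rel J x y))

  SingleLabelled : Bool
  SingleLabelled = anyFin (lab J) ∧ oneBlock

  single⁻ : T SingleLabelled → ∀ {x y} → T (lab J x) → T (lab J y) → T (rel J x y)
  single⁻ h lx ly =
    allFin⇒₂⁻ (λ x y → lab J x ∧ lab J y) (rel J) (proj₂ (T-∧⁻ {anyFin (lab J)} h)) (T-∧⁺ lx ly)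

  single⁺ : ∀ x₀ → T (lab J x₀) → (∀ {x y} → T (lab J x) → T (lab J y) → T (rel J x y)) →
            T SingleLabelled
  single⁺ x₀ l₀ one =
    T-∧⁺ {anyFin (lab J)} (anyFin⁺ (lab J) x₀ l₀)
      (allFin⇒₂⁺ (λ x y → lab J x ∧ lab J y) (rel J) (λ {x} t → let lx , ly = T-∧⁻ {lab J x} t in one lx ly))

-- The edge list of a Boolean relation on Fin n, as built inside joinLP.

relEdges : ∀ {n} → (Fin n → Fin n → Bool) → List (Fin n × Fin n)
relEdges {n} r = concatMap (λ x → map (λ y → (x , y)) (filterᵇ (r x) (allFin n))) (allFin n)

relEdges⁻ : ∀ {n} (r : Fin n → Fin n → Bool) {a c} → (a , c) ∈ relEdges r → T (r a c)
relEdges⁻ {n} r m with find (∈-concatMap⁻ (λ x → map (λ y → (x , y)) (filterᵇ (r x) (allFin n))) {xs = allFin n} m)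
... | x , _ , m′ with ∈-map⁻ (λ y → (x , y)) m′
...   | y , y∈ , refl = proj₂ (∈-filterᵇ⁻ {p = r x} {xs = allFin n} y∈)

relEdges⁺ : ∀ {n} (r : Fin n → Fin n → Bool) {a c} → T (r a c) → (a , c) ∈ relEdges r
relEdges⁺ {n} r {a} {c} t =
  ∈-concatMap⁺ (λ x → map (λ y → (x , y)) (filterᵇ (r x) (allFin n)))
    (lose (∈-allFin a) (∈-map⁺ (λ y → (a , y)) (∈-filterᵇ⁺ (∈-allFin c) t)))

module Join {n : ℕ} (Y : BSet n) (π σ : LPart n) where

  J : LPart n
  J = joinLP Y π σ

  step-rel : Fin n → Fin n → Bool
  step-rel x y = rel π x y ∨ rel σ x y

  JoinMove : Fin n → Fin n → Set
  JoinMove = Adj (relEdges step-rel)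

  join-rel⁻ : ∀ {x y} → T (rel J x y) → T (Y x) × T (Y y) × Star JoinMove x y
  join-rel⁻ {x} h =
    let yx , h = T-∧⁻ {Y x} h ; yy , w = T-∧⁻ h
    in yx , yy , BoundedWalks.walk≤-sound Fin._≟_ (relEdges step-rel) n w

  join-rel⁺ : ∀ {x y} → T (Y x) → T (Y y) → Star JoinMove x y → T (rel J x y)
  join-rel⁺ {x} {y} yx yy w =
    T-∧⁺ yx (T-∧⁺ yy (subst (λ k → T (walk≤ Fin._≟_ (relEdges step-rel) k x y))
                            (length-tabulate {n = n} (λ z → z))
      (BoundedWalks.walk≤-connected Fin._≟_ (relEdges step-rel) (allFin n)
        (λ {u} {v} _ → ∈-allFin u , ∈-allFin v) w)))

  join-lab⁻ : ∀ {x} → T (lab J x) → T (Y x) × ∃ λ z → T (rel J x z) × T (lab π z ∨ lab σ z)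
  join-lab⁻ {x} h =
    let yx , h = T-∧⁻ {Y x} h ; z , t = anyFin⁻ _ h ; r , l = T-∧⁻ {rel J x z} t
    in yx , z , r , l

  join-lab⁺ : ∀ {x} z → T (Y x) → T (rel J x z) → T (lab π z ∨ lab σ z) → T (lab J x)
  join-lab⁺ {x} z yx r l = T-∧⁺ yx (anyFin⁺ (λ y → rel J x y ∧ (lab π y ∨ lab σ y)) z (T-∧⁺ r l))

count : ∀ {A : Set} → (A → Bool) → List A → ℕ
count q xs = sum (map (indicator ∘ q) xs)

count-++ : ∀ {A : Set} (q : A → Bool) xs ys → count q (xs ++ ys) ≡ count q xs + count q ys
count-++ q xs ys = trans (cong sum (map-++ (indicator ∘ q) xs ys)) (sum-++ (map (indicator ∘ q) xs) _)

count-none : ∀ {A : Set} (q : A → Bool) xs → (∀ x → ¬ T (q x)) → count q xs ≡ 0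
count-none q []       none = refl
count-none q (x ∷ xs) none = cong₂ _+_ (indicator-¬T (none x)) (count-none q xs none)

count-concatMap : ∀ {A B C : Set} (xs : List A) (ys : List B) (c : A → B → C) (q : C → Bool)
                  (row : A → Bool) → (∀ a → count (q ∘ c a) ys ≡ indicator (row a)) →
                  count q (concatMap (λ a → map (c a) ys) xs) ≡ count row xs
count-concatMap []       ys c q row h = refl
count-concatMap (a ∷ xs) ys c q row h = begin
  count q (map (c a) ys ++ concatMap (λ a → map (c a) ys) xs)
    ≡⟨ count-++ q (map (c a) ys) _ ⟩
  count q (map (c a) ys) + count q (concatMap (λ a → map (c a) ys) xs)
    ≡⟨ cong₂ _+_ (trans (cong sum (sym (map-∘ ys))) (h a)) (count-concatMap xs ys c q row h) ⟩
  indicator (row a) + count row xs ∎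
  where open ≡-Reasoning

sum-if : ∀ {A : Set} (q : A → Bool) (L : ℕ) xs → sum (map (λ x → if q x then L else 0) xs) ≡ L * count q xs
sum-if q L []       = sym (*-zeroʳ L)
sum-if q L (x ∷ xs) with q x
... | true  = trans (cong (L +_) (sum-if q L xs)) (sym (*-suc L _))
... | false = sum-if q L xs

-- xs lists every element exactly once up to ≈: any test that holds exactly on
-- the ≈-class of some a₀ passes exactly one entry of xs.
ListsOnce : ∀ {A : Set} → (A → A → Set) → List A → Set
ListsOnce {A} _≈_ xs =
  ∀ (a₀ : A) (q : A → Bool) → (∀ a → T (q a) → a ≈ a₀) → (∀ a → a ≈ a₀ → T (q a)) →
  count q xs ≡ 1

bools-once : ListsOnce _≡_ bools
bools-once b₀ q only every = trans (cong₂ _+_ (check true) (cong (_+ 0) (check false))) (lemma b₀)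
  where
  check : ∀ b → indicator (q b) ≡ indicator (b ==ᵇ b₀)
  check b = cong indicator (T-ext (λ t → T-==ᵇ⁺ (only b t)) (λ t → every b (T-==ᵇ⁻ t)))
  lemma : ∀ b₀ → indicator (true ==ᵇ b₀) + (indicator (false ==ᵇ b₀) + 0) ≡ 1
  lemma true  = refl
  lemma false = refl

allFuns-once : ∀ {A : Set} {_≈_ : A → A → Set} → (∀ {a} → a ≈ a) → ∀ {xs} → ListsOnce _≈_ xs →
               ∀ k → ListsOnce (λ f g → ∀ i → f i ≈ g i) (allFuns xs k)
allFuns-once ≈-refl xs-once zero f₀ q only every = cong (_+ 0) (indicator-T (every _ (λ ())))
allFuns-once {A} {_≈_} ≈-refl {xs} xs-once (suc k) f₀ q only every =
  consing (λ _ _ → refl) (λ _ _ _ → refl)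
  where
  -- allFuns xs (suc k) prepends every head a to every tail g; the prepending
  -- function of allFuns is local to Defs, so we only use its two equations
  consing : ∀ {c : A → (Fin k → A) → Fin (suc k) → A} →
            (∀ a g → c a g Fin.zero ≡ a) → (∀ a g i → c a g (Fin.suc i) ≡ g i) →
            count q (concatMap (λ a → map (c a) (allFuns xs k)) xs) ≡ 1
  consing {c} head tail = trans (count-concatMap xs (allFuns xs k) c q row rows)
                                (xs-once (f₀ Fin.zero) row (λ a → head≈) row-every)
    where
    tail₀ : Fin k → A
    tail₀ i = f₀ (Fin.suc i)
    row : A → Bool
    row a = q (c a tail₀)
    close : ∀ {a g} → a ≈ f₀ Fin.zero → (∀ i → g i ≈ tail₀ i) → ∀ i → c a g i ≈ f₀ i
    close {a} {g} a≈ g≈ Fin.zero    = subst (_≈ f₀ Fin.zero) (sym (head a g)) a≈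
    close {a} {g} a≈ g≈ (Fin.suc i) = subst (_≈ tail₀ i) (sym (tail a g i)) (g≈ i)
    head≈ : ∀ {a g} → T (q (c a g)) → a ≈ f₀ Fin.zero
    head≈ {a} {g} t = subst (_≈ f₀ Fin.zero) (head a g) (only _ t Fin.zero)
    row-every : ∀ a → a ≈ f₀ Fin.zero → T (row a)
    row-every a a≈ = every _ (close a≈ (λ i → ≈-refl))
    rows : ∀ a → count (q ∘ c a) (allFuns xs k) ≡ indicator (row a)
    rows a with T? (row a)
    ... | yes t = trans (allFuns-once ≈-refl xs-once k tail₀ (q ∘ c a)
                           (λ g t′ i → subst (_≈ tail₀ i) (tail a g i) (only _ t′ (Fin.suc i)))
                           (λ g g≈ → every _ (close (head≈ t) g≈)))
                        (sym (indicator-T t))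
    ... | no ¬t = trans (count-none (q ∘ c a) (allFuns xs k) (λ g t′ → ¬t (row-every a (head≈ t′))))
                        (sym (indicator-¬T ¬t))

_≐_ : ∀ {n} → LPart n → LPart n → Set
σ ≐ τ = (∀ x y → rel σ x y ≡ rel τ x y) × (∀ x → lab σ x ≡ lab τ x)

allLP-once : ∀ n → ListsOnce _≐_ (allLP n)
allLP-once n σ₀ q only every =
  trans (count-concatMap (allFuns (allFuns bools n) n) (allFuns bools n) lpart q row rows)
        (allFuns-once (λ _ → refl) (allFuns-once refl bools-once n) n (rel σ₀) row
           (λ r t → proj₁ (only _ t)) (λ r r≐ → every _ (r≐ , λ _ → refl)))
  where
  row : (Fin n → Fin n → Bool) → Bool
  row r = q (lpart r (lab σ₀))
  rows : ∀ r → count (q ∘ lpart r) (allFuns bools n) ≡ indicator (row r)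
  rows r with T? (row r)
  ... | yes t = trans (allFuns-once refl bools-once n (lab σ₀) (q ∘ lpart r)
                         (λ l t′ → proj₂ (only _ t′)) (λ l l≐ → every _ (proj₁ (only _ t) , l≐)))
                      (sym (indicator-T t))
  ... | no ¬t = trans (count-none (q ∘ lpart r) (allFuns bools n)
                         (λ l t′ → ¬t (every _ (proj₁ (only _ t′) , λ _ → refl))))
                      (sym (indicator-¬T ¬t))

module Side {n m : ℕ} (e : Fin m → Fin n × Fin n) (K : BSet n) (V : Fin 2 → BSet n)
            (side : Fin m → Fin 2) (split : Splitting.IsKSplitting e K V side) (i : Fin 2) where
  open Splitting e K V side
  open IsKSplitting split

  Gᵢ : MGraph (Fin n)
  Gᵢ = Gi i

  Path : Fin n → Fin n → Set
  Path = Star (Adj (edges Gᵢ))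

  reversePath : ∀ {a b} → Path a b → Path b a
  reversePath = Star.reverse Adj-sym

  X⊆Vᵢ : ∀ {x} → T (X x) → T (V i x)
  X⊆Vᵢ = X⊆V i
    where
    X⊆V : ∀ j {x} → T (X x) → T (V j x)
    X⊆V Fin.zero           {x} xx = proj₁ (T-∧⁻ {V Fin.zero x} xx)
    X⊆V (Fin.suc Fin.zero) {x} xx = proj₂ (T-∧⁻ {V Fin.zero x} xx)

  Gᵢ-within : EdgesWithin (edges Gᵢ) (verts Gᵢ)
  Gᵢ-within uv∈ with ∈-map⁻ e uv∈
  ... | j , j∈ , refl with toWitness (proj₂ (∈-filterᵇ⁻ {p = λ j → ⌊ side j Fin.≟ i ⌋} {xs = allFin m} j∈))
  ...   | refl = let vu , vv = T-∧⁻ {V (side j) (proj₁ (e j))} (edgesIn j)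
                 in ∈-filterᵇ⁺ (∈-allFin _) vu , ∈-filterᵇ⁺ (∈-allFin _) vv

  conn : Fin n → Fin n → Bool
  conn = connected Fin._≟_ Gᵢ

  conn⁻ : ∀ {a b} → T (conn a b) → Path a b
  conn⁻ = Connectivity.connected-sound Fin._≟_ Gᵢ

  conn⁺ : ∀ {a b} → Path a b → T (conn a b)
  conn⁺ = Connectivity.connected-complete Fin._≟_ Gᵢ Gᵢ-within

  -- σ₀ = {(G^i, K^i)} ⊓ X: blocks are the traces on X of the components of G^i,
  -- a block being labelled iff its component meets K^i.
  traceRel : Fin n → Fin n → Bool
  traceRel x y = X x ∧ X y ∧ conn x y

  traceLab : Fin n → Bool
  traceLab x = X x ∧ anyFin (λ k → Ki i k ∧ conn x k)

  σ₀ : LPart n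
  σ₀ = lpart traceRel traceLab

  module Trace (σ : LPart n) (σ≐σ₀ : σ ≐ σ₀) where

    rel⁻ : ∀ {x y} → T (rel σ x y) → T (X x) × T (X y) × Path x y
    rel⁻ {x} {y} t =
      let xx , t = T-∧⁻ {X x} (subst T (proj₁ σ≐σ₀ x y) t) ; xy , c = T-∧⁻ {X y} t
      in xx , xy , conn⁻ c

    rel⁺ : ∀ {x y} → T (X x) → T (X y) → Path x y → T (rel σ x y)
    rel⁺ {x} {y} xx xy p = subst T (sym (proj₁ σ≐σ₀ x y)) (T-∧⁺ xx (T-∧⁺ xy (conn⁺ p)))

    lab⁻ : ∀ {x} → T (lab σ x) → T (X x) × ∃ λ k → T (Ki i k) × Path x k
    lab⁻ {x} t =
      let xx , t = T-∧⁻ {X x} (subst T (proj₂ σ≐σ₀ x) t) ; k , t = anyFin⁻ _ t ; kk , c = T-∧⁻ {Ki i k} t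
      in xx , k , kk , conn⁻ c

    lab⁺ : ∀ {x k} → T (X x) → T (Ki i k) → Path x k → T (lab σ x)
    lab⁺ {x} {k} xx kk p =
      subst T (sym (proj₂ σ≐σ₀ x)) (T-∧⁺ xx (anyFin⁺ (λ k → Ki i k ∧ conn x k) k (T-∧⁺ kk (conn⁺ p))))

    partition : IsLabelledPartition X σ
    partition = record
      { isEquivOn = record
        { supported  = λ t → let xx , xy , _ = rel⁻ t in xx , xy
        ; reflexive  = λ xx → rel⁺ xx xx ε
        ; symmetric  = λ t → let xx , xy , p = rel⁻ t in rel⁺ xy xx (reversePath p)
        ; transitive = λ t u → let xx , _ , p = rel⁻ t ; _ , xz , q = rel⁻ u in rel⁺ xx xz (p ◅◅ q) }
      ; labelled⊆      = λ t → proj₁ (lab⁻ t)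
      ; label-constant = λ t → let xx , xy , p = rel⁻ t in
          T-ext (λ l → let _ , k , kk , q = lab⁻ l in lab⁺ xy kk (reversePath p ◅◅ q))
                (λ l → let _ , k , kk , q = lab⁻ l in lab⁺ xx kk (p ◅◅ q)) }

  -- The condition tested by D(G^i, σ): σ is the trace of the components of G^i.
  IsTrace : LPart n → Bool
  IsTrace σ = validLP X σ
              ∧ allFin? (λ x → allFin? (λ y → (X x ∧ X y) ⇒ᵇ (rel σ x y ==ᵇ conn x y)))
              ∧ allFin? (λ x → X x ⇒ᵇ (lab σ x ==ᵇ anyFin (λ k → Ki i k ∧ conn x k)))

  -- the terms of the sum that can be non-zero
  Chosen : LPart n → Bool
  Chosen σ = inΠlXπX X K σ ∧ IsTrace σ

  -- Some component of G^i meets both X and K^i; then σ₀ has a labelled block.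
  MeetsX : Set
  MeetsX = ∃ λ x → T (X x) × ∃ λ k → T (Ki i k) × Path x k

  chosen⁻ : ∀ σ → T (Chosen σ) → σ ≐ σ₀
  chosen⁻ σ h = (λ x y → T-ext (rel→ x y) (rel← x y)) , (λ x → T-ext (lab→ x) (lab← x))
    where
    relsTraced : Bool
    relsTraced = allFin? (λ x → allFin? (λ y → (X x ∧ X y) ⇒ᵇ (rel σ x y ==ᵇ conn x y)))
    labsTraced : Bool
    labsTraced = allFin? (λ x → X x ⇒ᵇ (lab σ x ==ᵇ anyFin (λ k → Ki i k ∧ conn x k)))
    h-in : T (inΠlXπX X K σ)
    h-in = proj₁ (T-∧⁻ {inΠlXπX X K σ} h)
    h-traced : T (relsTraced ∧ labsTraced)
    h-traced = proj₂ (T-∧⁻ {validLP X σ} (proj₂ (T-∧⁻ {inΠlXπX X K σ} h)))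
    open IsLabelledPartition (InΠlXπX.partition (inΠlXπX⁻ X K σ h-in))
    rel≡ : ∀ {x y} → T (X x) → T (X y) → rel σ x y ≡ conn x y
    rel≡ xx xy = T-==ᵇ⁻ (allFin⇒₂⁻ (λ x y → X x ∧ X y) (λ x y → rel σ x y ==ᵇ conn x y)
                           (proj₁ (T-∧⁻ {relsTraced} h-traced)) (T-∧⁺ xx xy))
    lab≡ : ∀ {x} → T (X x) → lab σ x ≡ anyFin (λ k → Ki i k ∧ conn x k)
    lab≡ xx = T-==ᵇ⁻ (allFin⇒₁⁻ X (λ x → lab σ x ==ᵇ anyFin (λ k → Ki i k ∧ conn x k))
                        (proj₂ (T-∧⁻ {relsTraced} h-traced)) xx)
    rel→ : ∀ x y → T (rel σ x y) → T (traceRel x y)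
    rel→ x y t = let xx , xy = supported t in T-∧⁺ xx (T-∧⁺ xy (subst T (rel≡ xx xy) t))
    rel← : ∀ x y → T (traceRel x y) → T (rel σ x y)
    rel← x y t = let xx , t = T-∧⁻ {X x} t ; xy , c = T-∧⁻ {X y} t in subst T (sym (rel≡ xx xy)) c
    lab→ : ∀ x → T (lab σ x) → T (traceLab x)
    lab→ x t = let xx = labelled⊆ t in T-∧⁺ xx (subst T (lab≡ xx) t)
    lab← : ∀ x → T (traceLab x) → T (lab σ x)
    lab← x t = let xx , a = T-∧⁻ {X x} t in subst T (sym (lab≡ xx)) a

  chosen⁺ : MeetsX → ∀ σ → σ ≐ σ₀ → T (Chosen σ)
  chosen⁺ (x , xx , k , kk , p) σ σ≐σ₀ =
    T-∧⁺ {inΠlXπX X K σ}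
      (inΠlXπX⁺ X K σ (record
        { partition     = partition
        ; above-πX      = λ xx kx → lab⁺ xx (T-∧⁺ kx (X⊆Vᵢ xx)) ε
        ; some-labelled = x , lab⁺ xx kk p }))
      (T-∧⁺ {validLP X σ} (validLP⁺ X σ partition)
        (T-∧⁺ {allFin? (λ x → allFin? (λ y → (X x ∧ X y) ⇒ᵇ (rel σ x y ==ᵇ conn x y)))}
          (allFin⇒₂⁺ (λ x y → X x ∧ X y) (λ x y → rel σ x y ==ᵇ conn x y)
            (λ {x} t → let xx , xy = T-∧⁻ {X x} t in T-==ᵇ⁺ (rel≡conn xx xy)))
          (allFin⇒₁⁺ X (λ x → lab σ x ==ᵇ anyFin (λ k → Ki i k ∧ conn x k))
            (λ xx → T-==ᵇ⁺ (lab≡meets xx)))))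
    where
    open Trace σ σ≐σ₀
    rel≡conn : ∀ {x y} → T (X x) → T (X y) → rel σ x y ≡ conn x y
    rel≡conn xx xy = T-ext (λ t → conn⁺ (proj₂ (proj₂ (rel⁻ t)))) (λ c → rel⁺ xx xy (conn⁻ c))
    lab≡meets : ∀ {x} → T (X x) → lab σ x ≡ anyFin (λ k → Ki i k ∧ conn x k)
    lab≡meets {x} xx =
      T-ext (λ t → let _ , k , kk , p = lab⁻ t in anyFin⁺ (λ k → Ki i k ∧ conn x k) k (T-∧⁺ kk (conn⁺ p)))
            (λ a → let k , t = anyFin⁻ _ a ; kk , c = T-∧⁻ {Ki i k} t in lab⁺ xx kk (conn⁻ c))

  -- Terminals of K^i outside X stay singleton vertices in every merged graph.
  Outer : Fin n → Set
  Outer v = T (Ki i v) × ¬ T (X v)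

  isOuter : Fin n → Bool
  isOuter v = Ki i v ∧ not (X v)

  outerTerminals : List (Subset n)
  outerTerminals = map ⁅_⁆ (filterᵇ isOuter (allFin n))

  ∈-outer⁻ : ∀ {p} → p ∈ outerTerminals → ∃ λ v → Outer v × p ≡ ⁅ v ⁆
  ∈-outer⁻ p∈ with ∈-map⁻ ⁅_⁆ p∈
  ... | v , v∈ , refl =
    let kv , nx = T-∧⁻ {Ki i v} (proj₂ (∈-filterᵇ⁻ {p = isOuter} {xs = allFin n} v∈))
    in v , (kv , T-not⁻ nx) , refl

  ∈-outer⁺ : ∀ {v} → Outer v → ⁅ v ⁆ ∈ outerTerminals
  ∈-outer⁺ (kv , ¬xv) = ∈-map⁺ ⁅_⁆ (∈-filterᵇ⁺ (∈-allFin _) (T-∧⁺ kv (T-not⁺ ¬xv)))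

  Xrel : Fin n → Fin n → Bool
  Xrel x y = X x ∧ X y

  Xrel-equiv : IsEquivOn X Xrel
  Xrel-equiv = record
    { supported  = λ {x} t → T-∧⁻ {X x} t
    ; reflexive  = λ xx → T-∧⁺ xx xx
    ; symmetric  = λ {x} t → let xx , xy = T-∧⁻ {X x} t in T-∧⁺ xy xx
    ; transitive = λ {x} {y} t u → T-∧⁺ (proj₁ (T-∧⁻ {X x} t)) (proj₂ (T-∧⁻ {X y} u)) }

  module MX = Merging Xrel-equiv Gᵢ

  PX : Fin n → Set
  PX v = Outer v ⊎ T (X v)

  module TX = MergedTerminals Xrel-equiv Gᵢ (KiX i) PX

  X-block : ∀ {x} → T (X x) → MX.img x ≡ toSubset X
  X-block xx = trans (mergeImg-inside X Xrel xx) (tabulate-cong (λ y → cong (_∧ X y) (Equivalence.to T-≡ xx)))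

  linkedX⁻ : T (AllLinked _≟ˢ_ (GiX i) (KiX i)) → TX.Linked
  linkedX⁻ = TX.linked⁻ terminal
    where
    terminal : ∀ {v} → PX v → MX.img v ∈ KiX i
    terminal (inj₁ outer@(_ , ¬xv)) rewrite mergeImg-outside X Xrel ¬xv = ∈-++⁺ˡ (∈-outer⁺ outer)
    terminal (inj₂ xv) = ∈-++⁺ʳ outerTerminals (here (X-block xv))

  -- (the vertex X is a terminal of K^i_X, represented by some x₀ ∈ X)
  linkedX⁺ : ∀ {x₀} → T (X x₀) → TX.Linked → T (AllLinked _≟ˢ_ (GiX i) (KiX i))
  linkedX⁺ {x₀} xx₀ = TX.linked⁺ Gᵢ-within terminal
    where
    terminal : ∀ {p} → p ∈ KiX i → ∃ λ v → PX v × p ≡ MX.img v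
    terminal p∈ with ∈-++⁻ outerTerminals p∈
    ... | inj₁ p∈outer = let v , outer@(_ , ¬xv) , p≡ = ∈-outer⁻ p∈outer
                         in v , inj₁ outer , trans p≡ (sym (mergeImg-outside X Xrel ¬xv))
    ... | inj₂ (here refl) = x₀ , inj₂ xx₀ , sym (X-block xx₀)

  module WithPartition (π : LPart n) (π∈ : InΠlXπX X K π) where
    open InΠlXπX π∈
    open IsLabelledPartition partition
    module Mπ = Merging isEquivOn Gᵢ

    Pπ : Fin n → Set
    Pπ v = Outer v ⊎ (T (X v) × (T (lab π v) ⊎ ∃ λ y → T (rel π v y) × T (Ki i y)))

    module Tπ = MergedTerminals isEquivOn Gᵢ (Kiπ i π) Pπ

    private
      isInner : Fin n → Bool
      isInner x = X x ∧ (lab π x ∨ anyFin (λ y → rel π x y ∧ Ki i y))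

      inner⁻ : ∀ {v} → T (lab π v ∨ anyFin (λ y → rel π v y ∧ Ki i y)) →
               T (lab π v) ⊎ ∃ λ y → T (rel π v y) × T (Ki i y)
      inner⁻ {v} t with T-∨⁻ {lab π v} t
      ... | inj₁ l = inj₁ l
      ... | inj₂ a = let y , t = anyFin⁻ _ a in inj₂ (y , T-∧⁻ {rel π v y} t)

      inner⁺ : ∀ {v} → (T (lab π v) ⊎ ∃ λ y → T (rel π v y) × T (Ki i y)) →
               T (lab π v ∨ anyFin (λ y → rel π v y ∧ Ki i y))
      inner⁺ (inj₁ l) = T-∨ˡ l
      inner⁺ {v} (inj₂ (y , r , k)) = T-∨ʳ {lab π v} (anyFin⁺ (λ y → rel π v y ∧ Ki i y) y (T-∧⁺ r k))

    linkedπ⁻ : T (AllLinked _≟ˢ_ (Giπ i π) (Kiπ i π)) → Tπ.Linked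
    linkedπ⁻ = Tπ.linked⁻ terminal
      where
      terminal : ∀ {v} → Pπ v → Mπ.img v ∈ Kiπ i π
      terminal (inj₁ outer@(_ , ¬xv)) rewrite mergeImg-outside X (rel π) ¬xv = ∈-++⁺ˡ (∈-outer⁺ outer)
      terminal {v} (inj₂ (xv , c)) rewrite mergeImg-inside X (rel π) xv =
        ∈-++⁺ʳ outerTerminals (∈-map⁺ (λ x → toSubset (rel π x))
          (∈-filterᵇ⁺ (∈-allFin v) (T-∧⁺ xv (inner⁺ c))))

    linkedπ⁺ : Tπ.Linked → T (AllLinked _≟ˢ_ (Giπ i π) (Kiπ i π))
    linkedπ⁺ = Tπ.linked⁺ Gᵢ-within terminal
      where
      terminal : ∀ {p} → p ∈ Kiπ i π → ∃ λ v → Pπ v × p ≡ Mπ.img v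
      terminal p∈ with ∈-++⁻ outerTerminals p∈
      ... | inj₁ p∈outer = let v , outer@(_ , ¬xv) , p≡ = ∈-outer⁻ p∈outer
                           in v , inj₁ outer , trans p≡ (sym (mergeImg-outside X (rel π) ¬xv))
      ... | inj₂ p∈inner with ∈-map⁻ (λ x → toSubset (rel π x)) p∈inner
      ...   | v , v∈ , refl = let xv , c = T-∧⁻ {X v} (proj₂ (∈-filterᵇ⁻ {p = isInner} {xs = allFin n} v∈))
                              in v , inj₂ (xv , inner⁻ c) , sym (mergeImg-inside X (rel π) xv)

    x₀ : Fin n
    x₀ = proj₁ some-labelled

    x₀∈X : T (X x₀)
    x₀∈X = labelled⊆ (proj₂ some-labelled)

    coarsen : ∀ {a c} → Mπ.Move a c → MX.Move a c
    coarsen (inj₁ r) = inj₁ r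
    coarsen (inj₂ t) = let xa , xc = supported t in inj₂ (T-∧⁺ xa xc)

    -- M(G^i_π, K^i_π) = 1 implies M(G^i_X, K^i_X) = 1: route every terminal to x₀.
    linkedπ→linkedX : Tπ.Linked → TX.Linked
    linkedπ→linkedX linked pa pb = toX₀ pa ◅◅ Star.reverse MX.Move-sym (toX₀ pb)
      where
      toX₀ : ∀ {a} → PX a → Star MX.Move a x₀
      toX₀ (inj₁ outer) = Star.map coarsen (linked (inj₁ outer) (inj₂ (x₀∈X , inj₁ (proj₂ some-labelled))))
      toX₀ (inj₂ xa)    = inj₂ (T-∧⁺ xa x₀∈X) ◅ ε

    -- If M(G^i_X, K^i_X) = 1, every outer terminal reaches X along edges of G^i,
    -- and in particular the component partition σ₀ has a labelled block.
    outer-reaches-X : TX.Linked → ∀ {v} → Outer v → ∃ λ x → T (X x) × Path v x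
    outer-reaches-X linked outer = MX.first-entry (linked (inj₁ outer) (inj₂ x₀∈X)) x₀∈X

    meetsX : TX.Linked → MeetsX
    meetsX linked with Kmeets i
    ... | k , kk with T? (X k)
    ...   | yes xk = k , xk , k , kk , ε
    ...   | no ¬xk = let x , xx , p = outer-reaches-X linked (kk , ¬xk) in x , xx , k , kk , reversePath p

    module Core (σ : LPart n) (σ≐σ₀ : σ ≐ σ₀) (linkedX : TX.Linked) where
      open Trace σ σ≐σ₀
      open Join X π σ

      path→π : ∀ {a b} → Path a b → Star Mπ.Move a b
      path→π = Star.map inj₁

      -- a σ-step is a path of G^i, a π-step is a move of G^i_π
      joinMove→π : ∀ {a c} → JoinMove a c → Star Mπ.Move a c
      joinMove→π (inj₁ m) = forward (relEdges⁻ step-rel m)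
        where
        forward : ∀ {a c} → T (step-rel a c) → Star Mπ.Move a c
        forward {a} t with T-∨⁻ {rel π a _} t
        ... | inj₁ r = inj₂ r ◅ ε
        ... | inj₂ s = path→π (proj₂ (proj₂ (rel⁻ s)))
      joinMove→π (inj₂ m) = Star.reverse Mπ.Move-sym (joinMove→π (inj₁ m))

      join→π : ∀ {a b} → Star JoinMove a b → Star Mπ.Move a b
      join→π = joinMove→π Star.⋆

      σ-jump : ∀ {a c} → T (X a) → T (X c) → Path a c → JoinMove a c
      σ-jump {a} xa xc p = inj₁ (relEdges⁺ step-rel (T-∨ʳ {rel π a _} (rel⁺ xa xc p)))

      π-jump : ∀ {a c} → T (rel π a c) → JoinMove a c
      π-jump r = inj₁ (relEdges⁺ step-rel (T-∨ˡ r))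

      -- A walk of G^i_π between elements of X is a chain in π ∨ σ: every maximal
      -- stretch of G^i-edges (the accumulated path p) joins two elements of X.
      π→join : ∀ {a c b} → T (X a) → Path a c → Star Mπ.Move c b → T (X b) → Star JoinMove a b
      π→join xa p ε            xb = σ-jump xa xb p ◅ ε
      π→join xa p (inj₁ r ◅ w) xb = π→join xa (p ◅◅ r ◅ ε) w xb
      π→join xa p (inj₂ t ◅ w) xb =
        let xc , xd = supported t in σ-jump xa xc p ◅ π-jump t ◅ π→join xd ε w xb

      labelled-self : ∀ {x} → T (X x) → T (lab π x ∨ lab σ x) → T (lab J x)
      labelled-self {x} xx l = join-lab⁺ x xx (join-rel⁺ xx xx ε) l

      anchor : ∀ {p} → Pπ p → ∃ λ x → T (lab J x) × Star Mπ.Move p x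
      anchor (inj₁ outer@(kp , _)) =
        let x , xx , path = outer-reaches-X linkedX outer
        in x , labelled-self xx (T-∨ʳ {lab π x} (lab⁺ xx kp (reversePath path))) , path→π path
      anchor {p} (inj₂ (xp , inj₁ lp)) = p , labelled-self xp (T-∨ˡ lp) , ε
      anchor {p} (inj₂ (xp , inj₂ (y , r , ky))) =
        let xy = proj₂ (supported r)
        in p , join-lab⁺ y xp (join-rel⁺ xp xy (π-jump r ◅ ε)) (T-∨ʳ {lab π y} (lab⁺ xy ky ε)) , ε

      back : ∀ {x} → T (lab J x) → ∃ λ p → Pπ p × Star Mπ.Move x p
      back lx with join-lab⁻ lx
      ... | _ , z , rz , lz with join-rel⁻ rz | T-∨⁻ {lab π z} lz
      ...   | _ , xz , w | inj₁ lπ = z , inj₂ (xz , inj₁ lπ) , join→π w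
      ...   | _ , xz , w | inj₂ lσ with lab⁻ lσ
      ...     | _ , k , kk , path with T? (X k)
      ...       | yes xk =
        k , inj₂ (xk , inj₁ (above-πX xk (proj₁ (T-∧⁻ {K k} kk)))) , join→π w ◅◅ path→π path
      ...       | no ¬xk = k , inj₁ (kk , ¬xk) , join→π w ◅◅ path→π path

      single→linked : T (SingleLabelled J) → Tπ.Linked
      single→linked h pa pb =
        let xa , la , wa = anchor pa ; xb , lb , wb = anchor pb ; _ , _ , w = join-rel⁻ (single⁻ J h la lb)
        in wa ◅◅ join→π w ◅◅ Star.reverse Mπ.Move-sym wb

      linked→single : Tπ.Linked → T (SingleLabelled J)
      linked→single linked = single⁺ J x₀ (labelled-self x₀∈X (T-∨ˡ (proj₂ some-labelled))) joined
        where
        joined : ∀ {x y} → T (lab J x) → T (lab J y) → T (rel J x y)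
        joined lx ly =
          let _ , tx , wx = back lx ; _ , ty , wy = back ly
              xx = proj₁ (join-lab⁻ lx) ; xy = proj₁ (join-lab⁻ ly)
          in join-rel⁺ xx xy (π→join xx ε (wx ◅◅ linked tx ty ◅◅ Star.reverse Mπ.Move-sym wy) xy)

      core : SingleLabelled J ≡ AllLinked _≟ˢ_ (Giπ i π) (Kiπ i π)
      core = T-ext (linkedπ⁺ ∘ single→linked) (linked→single ∘ linkedπ⁻)

    sum-collapses : TX.Linked → RHSsum i π ≡ indicator (AllLinked _≟ˢ_ (Giπ i π) (Kiπ i π))
    sum-collapses linked = begin
      RHSsum i π                                  ≡⟨ cong sum (map-cong term (allLP n)) ⟩
      sum (map (λ σ → if Chosen σ then Lπ else 0) (allLP n)) ≡⟨ sum-if Chosen Lπ (allLP n) ⟩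
      Lπ * count Chosen (allLP n)                 ≡⟨ cong (Lπ *_) σ₀-unique ⟩
      Lπ * 1                                      ≡⟨ *-identityʳ Lπ ⟩
      Lπ                                          ∎
      where
      open ≡-Reasoning
      Lπ : ℕ
      Lπ = indicator (AllLinked _≟ˢ_ (Giπ i π) (Kiπ i π))
      σ₀-unique : count Chosen (allLP n) ≡ 1
      σ₀-unique = allLP-once n σ₀ Chosen chosen⁻ (chosen⁺ (meetsX linked))
      term : ∀ σ → (if inΠlXπX X K σ then Dv i σ * mv (joinLP X π σ) else 0) ≡ (if Chosen σ then Lπ else 0)
      term σ = trans (if-indicator-* (inΠlXπX X K σ) (IsTrace σ) (mv (joinLP X π σ)))
                     (if-cong (Chosen σ) (λ t → cong indicator (Core.core σ (chosen⁻ σ t) linked)))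

theorem5p18 : ∀ {n m : ℕ} (e : Fin m → Fin n × Fin n) → Loopless e →
    (K : BSet n) → AtLeastTwo K →
    (V : Fin 2 → BSet n) (side : Fin m → Fin 2) →
    Splitting.IsKSplitting e K V side →
    (π : LPart n) → T (inΠlXπX (Splitting.X e K V side) K π) →
    (i : Fin 2) →
    Mv _≟ˢ_ (Splitting.Giπ e K V side i π) (Splitting.Kiπ e K V side i π)
    ≡ Mv _≟ˢ_ (Splitting.GiX e K V side i) (Splitting.KiX e K V side i)
    * Splitting.RHSsum e K V side i π
theorem5p18 e _ K _ V side split π π∈ i = byCases (T? (AllLinked _≟ˢ_ (GiX i) (KiX i)))
  where
  open Splitting e K V side
  open Side e K V side split i
  open WithPartition π (inΠlXπX⁻ X K π π∈)
  open ≡-Reasoning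

  Mπ MX : ℕ
  Mπ = indicator (AllLinked _≟ˢ_ (Giπ i π) (Kiπ i π))
  MX = indicator (AllLinked _≟ˢ_ (GiX i) (KiX i))

  byCases : Dec (T (AllLinked _≟ˢ_ (GiX i) (KiX i))) → Mπ ≡ MX * RHSsum i π
  byCases (yes linkedX) = begin
    Mπ               ≡⟨ sum-collapses (linkedX⁻ linkedX) ⟨
    RHSsum i π       ≡⟨ +-identityʳ (RHSsum i π) ⟨
    1 * RHSsum i π   ≡⟨ cong (_* RHSsum i π) (indicator-T linkedX) ⟨
    MX * RHSsum i π  ∎
  byCases (no ¬linkedX) = begin
    Mπ               ≡⟨ indicator-¬T (¬linkedX ∘ linkedX⁺ x₀∈X ∘ linkedπ→linkedX ∘ linkedπ⁻) ⟩
    0                ≡⟨ cong (_* RHSsum i π) (indicator-¬T ¬linkedX) ⟨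
    MX * RHSsum i π  ∎
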